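{- For all natural numbers $s,k$, as polynomials in $x$, $$\mathcal F_{s,k}(x)=\sum_{i=1}^{k}(-1)^{i-1}(i-1)!\left\{{k\atop i}\right\}\binom{x-i}{s-i}$$ and $$\mathcal F_{s,k}(x)=\sum_{i=0}^{k}(-1)^{i+k-1}\,i!\left\{{k-1\atop i}\right\}\binom{x-i-1}{s-1}.$$
   Context: The Moser polynomial is $\mathcal F_{s,k}(x)=\sum_{j=1}^{s}(-1)^{j-1}j^{k-1}\binom{x}{s-j}$, where $\binom{x}{m}=x(x-1)\cdots(x-m+1)/m!$ for $m\ge0$ and $\binom xm=0$ for $m<0$. $\left\{{n\atop m}\right\}$ denotes the Stirling number of the second kind, with $\left\{{0\atop 0}\right\}=1$ and $\left\{{n\atop 0}\right\}=0$ for $n\ge1$. -}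

module Defs where

open import Data.Nat using (ℕ; zero; suc; _!)
open import Data.Nat.Properties using (_!≢0)
open import Data.Integer as ℤ using (ℤ; +_; -[1+_])
open import Data.Rational using (ℚ; _+_; _*_; _-_; _/_; -_; 0ℚ; 1ℚ)

ℕ→ℚ : ℕ → ℚ
ℕ→ℚ n = (+ n) / 1

sgn : ℕ → ℚ
sgn zero = 1ℚ
sgn (suc n) = - sgn n

falling : ℚ → ℕ → ℚ
falling x zero = 1ℚ
falling x (suc m) = falling x m * (x - ℕ→ℚ m)

binom : ℚ → ℤ → ℚ
binom x (+ m) = falling x m * ((+ 1 / (m !)) {{m !≢0}})
binom x -[1+ m ] = 0ℚ

stirling2 : ℕ → ℕ → ℕ
stirling2 zero zero = 1
stirling2 zero (suc m) = 0
stirling2 (suc n) zero = 0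
stirling2 (suc n) (suc m) = suc m ℕ.* stirling2 n (suc m) ℕ.+ stirling2 n m
  where import Data.Nat as ℕ

sum0 : ℕ → (ℕ → ℚ) → ℚ
sum0 zero f = f 0
sum0 (suc n) f = sum0 n f + f (suc n)

sum1 : ℕ → (ℕ → ℚ) → ℚ
sum1 zero f = 0ℚ
sum1 (suc n) f = sum1 n f + f (suc n)

_⊖ℤ_ : ℕ → ℕ → ℤ
a ⊖ℤ b = (+ a) ℤ.- (+ b)

-- Moser polynomial F_{s,k}(x) = Σ_{j=1}^{s} (-1)^{j-1} j^{k-1} binom(x, s-j)
-- (k ≥ 1 is assumed where used; k-1 is natural subtraction)
moser : ℕ → ℕ → ℚ → ℚ
moser s k x = sum1 s (λ j → sgn (j ∸ 1) * ℕ→ℚ (j ^ (k ∸ 1)) * binom x (s ⊖ℤ j))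
  where open import Data.Nat using (_∸_; _^_)

module Submission where

-- All three expressions (F itself and the two right-hand sides) are
-- families G k s x (standing for the value at k+1) satisfying the same
-- recurrence in k:
--   G 0 s x         = C(x-1, s-1),
--   G (k+1) 0 x     = 0,
--   G (k+1) (s+1) x = (s+1) G k (s+1) x - x G k s (x-1),
-- and such a family is unique (induction on k, then s).

module MoserStirling where
  open import Defs
  open import Data.Nat as ℕ using (ℕ; zero; suc; _∸_; _^_; _!; s≤s)
  import Data.Nat.Properties as ℕ
  open import Data.Nat.Properties using (_!≢0)
  import Data.Nat.Coprimality as Coprimality
  open import Data.Integer as ℤ using (+_; -[1+_])
  import Data.Integer.Properties as ℤ
  open import Data.Rational using (ℚ; mkℚ; _+_; _*_; _-_; -_; _/_; 0ℚ; 1ℚ; 1/_)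
  import Data.Rational.Properties as ℚ
  open import Level using (0ℓ)
  open import Relation.Nullary.Decidable using (dec⇒maybe)
  open import Data.List using ([]; _∷_)
  open import Tactic.RingSolver using (solve; solve-∀)
  open import Tactic.RingSolver.Core.AlmostCommutativeRing using (AlmostCommutativeRing; fromCommutativeRing)
  open import Relation.Binary.PropositionalEquality
  open ≡-Reasoning

  ℚ-ring : AlmostCommutativeRing 0ℓ 0ℓ
  ℚ-ring = fromCommutativeRing ℚ.+-*-commutativeRing (λ x → dec⇒maybe (0ℚ ℚ.≟ x))

  -- r - c (a - b) = r once a = b: the last step of each algebraic rearrangement below
  discard : ∀ r c {a b} → a ≡ b → r - c * (a - b) ≡ r
  discard r c {a} refl = solve (r ∷ c ∷ a ∷ []) ℚ-ring

  ℕ→ℚ-mkℚ : ∀ n → ℕ→ℚ n ≡ mkℚ (+ n) 0 (Coprimality.sym (Coprimality.1-coprimeTo n))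
  ℕ→ℚ-mkℚ n = ℚ.normalize-coprime _

  ℕ→ℚ-+ : ∀ m n → ℕ→ℚ (m ℕ.+ n) ≡ ℕ→ℚ m + ℕ→ℚ n
  ℕ→ℚ-+ m n = begin
    ℕ→ℚ (m ℕ.+ n)
      ≡⟨ ℚ./-cong (sym (cong₂ ℤ._+_ (ℤ.*-identityʳ (+ m)) (ℤ.*-identityʳ (+ n)))) refl ⟩
    (+ m ℤ.* + 1 ℤ.+ + n ℤ.* + 1) / 1  ≡⟨ cong₂ _+_ (ℕ→ℚ-mkℚ m) (ℕ→ℚ-mkℚ n) ⟨
    ℕ→ℚ m + ℕ→ℚ n                     ∎

  ℕ→ℚ-* : ∀ m n → ℕ→ℚ (m ℕ.* n) ≡ ℕ→ℚ m * ℕ→ℚ n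
  ℕ→ℚ-* m n = begin
    ℕ→ℚ (m ℕ.* n)     ≡⟨ ℚ./-cong (ℤ.pos-* m n) refl ⟩
    (+ m ℤ.* + n) / 1  ≡⟨ cong₂ _*_ (ℕ→ℚ-mkℚ m) (ℕ→ℚ-mkℚ n) ⟨
    ℕ→ℚ m * ℕ→ℚ n     ∎

  ℕ→ℚ-suc : ∀ n → ℕ→ℚ (suc n) ≡ 1ℚ + ℕ→ℚ n
  ℕ→ℚ-suc = ℕ→ℚ-+ 1

  ℕ→ℚ-inverse : ∀ n .{{_ : ℕ.NonZero n}} → ℕ→ℚ n * (+ 1 / n) ≡ 1ℚ
  ℕ→ℚ-inverse (suc n) = begin
    ℕ→ℚ (suc n) * (+ 1 / suc n)
      ≡⟨ cong₂ _*_ (ℕ→ℚ-mkℚ (suc n)) (ℚ.normalize-coprime (Coprimality.1-coprimeTo (suc n))) ⟩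
    p * 1/ p                     ≡⟨ ℚ.*-inverseʳ p ⟩
    1ℚ                           ∎
    where p = mkℚ (+ suc n) 0 (Coprimality.sym (Coprimality.1-coprimeTo (suc n)))

  minus-suc : ∀ x n → x - ℕ→ℚ (suc n) ≡ x - ℕ→ℚ n - 1ℚ
  minus-suc x n = begin
    x - ℕ→ℚ (suc n)     ≡⟨ cong (λ t → x - t) (ℕ→ℚ-suc n) ⟩
    x - (1ℚ + ℕ→ℚ n)    ≡⟨ regroup x (ℕ→ℚ n) ⟩
    x - ℕ→ℚ n - 1ℚ      ∎
    where
    regroup : ∀ x a → x - (1ℚ + a) ≡ x - a - 1ℚ
    regroup = solve-∀ ℚ-ring

  difference-suc : ∀ m n → ℕ→ℚ (suc m) - ℕ→ℚ (suc n) ≡ ℕ→ℚ m - ℕ→ℚ n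
  difference-suc m n = begin
    ℕ→ℚ (suc m) - ℕ→ℚ (suc n)        ≡⟨ cong₂ _-_ (ℕ→ℚ-suc m) (ℕ→ℚ-suc n) ⟩
    (1ℚ + ℕ→ℚ m) - (1ℚ + ℕ→ℚ n)      ≡⟨ cancel (ℕ→ℚ m) (ℕ→ℚ n) ⟩
    ℕ→ℚ m - ℕ→ℚ n                    ∎
    where
    cancel : ∀ a b → (1ℚ + a) - (1ℚ + b) ≡ a - b
    cancel = solve-∀ ℚ-ring

  sum0-cong : ∀ n {f g : ℕ → ℚ} → (∀ i → f i ≡ g i) → sum0 n f ≡ sum0 n g
  sum0-cong zero    f≡g = f≡g 0
  sum0-cong (suc n) f≡g = cong₂ _+_ (sum0-cong n f≡g) (f≡g (suc n))

  sum1-cong : ∀ n {f g : ℕ → ℚ} → (∀ i → f (suc i) ≡ g (suc i)) → sum1 n f ≡ sum1 n g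
  sum1-cong zero    f≡g = refl
  sum1-cong (suc n) f≡g = cong₂ _+_ (sum1-cong n f≡g) (f≡g n)

  sum0-zero : ∀ n (f : ℕ → ℚ) → (∀ i → f i ≡ 0ℚ) → sum0 n f ≡ 0ℚ
  sum0-zero zero    f f≡0 = f≡0 0
  sum0-zero (suc n) f f≡0 = cong₂ _+_ (sum0-zero n f f≡0) (f≡0 (suc n))

  sum1≡sum0 : ∀ n (f : ℕ → ℚ) → f 0 ≡ 0ℚ → sum1 n f ≡ sum0 n f
  sum1≡sum0 zero    f f0≡0 = sym f0≡0
  sum1≡sum0 (suc n) f f0≡0 = cong (_+ f (suc n)) (sum1≡sum0 n f f0≡0)

  private
    interchange : ∀ a b F G u v → a * F - b * G + (a * u - b * v) ≡ a * (F + u) - b * (G + v)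
    interchange = solve-∀ ℚ-ring

  sum0-linear : ∀ n a b (f g : ℕ → ℚ) → sum0 n (λ i → a * f i - b * g i) ≡ a * sum0 n f - b * sum0 n g
  sum0-linear zero    a b f g = refl
  sum0-linear (suc n) a b f g = begin
    sum0 n (λ i → a * f i - b * g i) + (a * f (suc n) - b * g (suc n))
      ≡⟨ cong (_+ (a * f (suc n) - b * g (suc n))) (sum0-linear n a b f g) ⟩
    a * sum0 n f - b * sum0 n g + (a * f (suc n) - b * g (suc n))
      ≡⟨ interchange a b (sum0 n f) (sum0 n g) (f (suc n)) (g (suc n)) ⟩
    a * sum0 (suc n) f - b * sum0 (suc n) g ∎

  sum1-linear : ∀ n a b (f g : ℕ → ℚ) → sum1 n (λ i → a * f i - b * g i) ≡ a * sum1 n f - b * sum1 n g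
  sum1-linear zero    a b f g = solve (a ∷ b ∷ []) ℚ-ring
  sum1-linear (suc n) a b f g = begin
    sum1 n (λ i → a * f i - b * g i) + (a * f (suc n) - b * g (suc n))
      ≡⟨ cong (_+ (a * f (suc n) - b * g (suc n))) (sum1-linear n a b f g) ⟩
    a * sum1 n f - b * sum1 n g + (a * f (suc n) - b * g (suc n))
      ≡⟨ interchange a b (sum1 n f) (sum1 n g) (f (suc n)) (g (suc n)) ⟩
    a * sum1 (suc n) f - b * sum1 (suc n) g ∎

  sum1-negate : ∀ n (f : ℕ → ℚ) → sum1 n (λ i → - f i) ≡ - sum1 n f
  sum1-negate zero    f = refl
  sum1-negate (suc n) f = begin
    sum1 n (λ i → - f i) + - f (suc n)  ≡⟨ cong (_+ - f (suc n)) (sum1-negate n f) ⟩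
    - sum1 n f + - f (suc n)            ≡⟨ ℚ.neg-distrib-+ (sum1 n f) (f (suc n)) ⟨
    - sum1 (suc n) f                    ∎

  sum1-peel : ∀ n (f : ℕ → ℚ) → sum1 (suc n) f ≡ f 1 + sum1 n (λ i → f (suc i))
  sum1-peel zero    f = trans (ℚ.+-identityˡ (f 1)) (sym (ℚ.+-identityʳ (f 1)))
  sum1-peel (suc n) f = begin
    sum1 (suc n) f + f (suc (suc n))                     ≡⟨ cong (_+ f (suc (suc n))) (sum1-peel n f) ⟩
    f 1 + sum1 n (λ i → f (suc i)) + f (suc (suc n))     ≡⟨ ℚ.+-assoc (f 1) _ _ ⟩
    f 1 + sum1 (suc n) (λ i → f (suc i))                 ∎

  falling-suc : ∀ y n → falling y (suc n) ≡ y * falling (y - 1ℚ) n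
  falling-suc y zero    = unit y
    where
    unit : ∀ y → 1ℚ * (y - 0ℚ) ≡ y * 1ℚ
    unit = solve-∀ ℚ-ring
  falling-suc y (suc n) = begin
    falling y (suc n) * (y - ℕ→ℚ (suc n))           ≡⟨ cong₂ (λ p q → p * (y - q)) (falling-suc y n) (ℕ→ℚ-suc n) ⟩
    y * falling (y - 1ℚ) n * (y - (1ℚ + ℕ→ℚ n))     ≡⟨ regroup y (falling (y - 1ℚ) n) (ℕ→ℚ n) ⟩
    y * (falling (y - 1ℚ) n * (y - 1ℚ - ℕ→ℚ n))     ∎
    where
    regroup : ∀ y p a → y * p * (y - (1ℚ + a)) ≡ y * (p * (y - 1ℚ - a))
    regroup = solve-∀ ℚ-ring

  invFact : ℕ → ℚ
  invFact n = (+ 1 / n !) {{n !≢0}}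

  invFact-suc : ∀ n → ℕ→ℚ (suc n) * invFact (suc n) ≡ invFact n
  invFact-suc n = begin
    c * I₁               ≡⟨ ℚ.*-identityʳ (c * I₁) ⟨
    c * I₁ * 1ℚ          ≡⟨ cong (c * I₁ *_) (ℕ→ℚ-inverse (n !) {{n !≢0}}) ⟨
    c * I₁ * (F * I₀)    ≡⟨ regroup c I₁ F I₀ ⟩
    c * F * I₁ * I₀      ≡⟨ cong (λ a → a * I₁ * I₀) (ℕ→ℚ-* (suc n) (n !)) ⟨
    ℕ→ℚ (suc n !) * I₁ * I₀  ≡⟨ cong (_* I₀) (ℕ→ℚ-inverse (suc n !) {{suc n !≢0}}) ⟩
    1ℚ * I₀              ≡⟨ ℚ.*-identityˡ I₀ ⟩
    I₀                   ∎
    where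
    c = ℕ→ℚ (suc n)
    F = ℕ→ℚ (n !)
    I₁ = invFact (suc n)
    I₀ = invFact n
    regroup : ∀ c I₁ F I₀ → c * I₁ * (F * I₀) ≡ c * F * I₁ * I₀
    regroup = solve-∀ ℚ-ring

  absorption : ∀ y n → ℕ→ℚ (suc n) * binom y (+ suc n) ≡ y * binom (y - 1ℚ) (+ n)
  absorption y n = begin
    c * (falling y (suc n) * invFact (suc n))      ≡⟨ cong (λ p → c * (p * invFact (suc n))) (falling-suc y n) ⟩
    c * (y * P * invFact (suc n))                  ≡⟨ regroup c y P (invFact (suc n)) ⟩
    y * P * (c * invFact (suc n))                  ≡⟨ cong (y * P *_) (invFact-suc n) ⟩
    y * P * invFact n                              ≡⟨ ℚ.*-assoc y P (invFact n) ⟩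
    y * (P * invFact n)                            ∎
    where
    c = ℕ→ℚ (suc n)
    P = falling (y - 1ℚ) n
    regroup : ∀ c y P J → c * (y * P * J) ≡ y * P * (c * J)
    regroup = solve-∀ ℚ-ring

  pascal : ∀ y n → binom y (+ suc n) ≡ binom (y - 1ℚ) (+ suc n) + binom (y - 1ℚ) (+ n)
  pascal y n = begin
    falling y (suc n) * I                      ≡⟨ cong (_* I) (falling-suc y n) ⟩
    y * P * I                                  ≡⟨ split y P I (ℕ→ℚ n) ⟩
    P * (y - 1ℚ - ℕ→ℚ n) * I + P * ((1ℚ + ℕ→ℚ n) * I)
      ≡⟨ cong (λ c → P * (y - 1ℚ - ℕ→ℚ n) * I + P * (c * I)) (ℕ→ℚ-suc n) ⟨
    P * (y - 1ℚ - ℕ→ℚ n) * I + P * (ℕ→ℚ (suc n) * I)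
      ≡⟨ cong (λ c → P * (y - 1ℚ - ℕ→ℚ n) * I + P * c) (invFact-suc n) ⟩
    P * (y - 1ℚ - ℕ→ℚ n) * I + P * invFact n   ∎
    where
    P = falling (y - 1ℚ) n
    I = invFact (suc n)
    split : ∀ y P I a → y * P * I ≡ P * (y - 1ℚ - a) * I + P * ((1ℚ + a) * I)
    split = solve-∀ ℚ-ring

  ⊖ℤ-suc : ∀ s i → suc s ⊖ℤ suc i ≡ s ⊖ℤ i
  ⊖ℤ-suc s i = trans (ℤ.[1+m]⊖[1+n]≡m⊖n s i) (sym (ℤ.[+m]-[+n]≡m⊖n s i))

  ⊖ℤ-zero : ∀ s → s ⊖ℤ 0 ≡ + s
  ⊖ℤ-zero s = ℤ.+-identityʳ (+ s)

  ⊖ℤ-one : ∀ s → suc s ⊖ℤ 1 ≡ + s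
  ⊖ℤ-one s = trans (⊖ℤ-suc s 0) (⊖ℤ-zero s)

  ⊖ℤ-suc-self : ∀ s → s ⊖ℤ suc s ≡ -[1+ 0 ]
  ⊖ℤ-suc-self zero    = refl
  ⊖ℤ-suc-self (suc s) = trans (⊖ℤ-suc s (suc s)) (⊖ℤ-suc-self s)

  absorption-⊖ : ∀ s i y → (ℕ→ℚ (suc s) - ℕ→ℚ i) * binom y (suc s ⊖ℤ i) ≡ y * binom (y - 1ℚ) (s ⊖ℤ i)
  absorption-⊖ s zero y = begin
    (ℕ→ℚ (suc s) - 0ℚ) * binom y (suc s ⊖ℤ 0)
      ≡⟨ cong₂ (λ a n → a * binom y n) (minus-zero (ℕ→ℚ (suc s))) (⊖ℤ-zero (suc s)) ⟩
    ℕ→ℚ (suc s) * binom y (+ suc s)   ≡⟨ absorption y s ⟩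
    y * binom (y - 1ℚ) (+ s)          ≡⟨ cong (λ n → y * binom (y - 1ℚ) n) (⊖ℤ-zero s) ⟨
    y * binom (y - 1ℚ) (s ⊖ℤ 0)       ∎
    where
    minus-zero : ∀ a → a - 0ℚ ≡ a
    minus-zero = solve-∀ ℚ-ring
  -- s = 0, i = 1: the factor 1 - 1 vanishes, as does C(y-1, -1)
  absorption-⊖ zero (suc zero) y = sym (ℚ.*-zeroʳ y)
  -- s = 0, i ≥ 2: both lower indices are negative
  absorption-⊖ zero (suc (suc i)) y = trans (ℚ.*-zeroʳ (1ℚ - ℕ→ℚ (suc (suc i)))) (sym (ℚ.*-zeroʳ y))
  absorption-⊖ (suc s) (suc i) y = begin
    (ℕ→ℚ (suc (suc s)) - ℕ→ℚ (suc i)) * binom y (suc (suc s) ⊖ℤ suc i)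
      ≡⟨ cong₂ (λ a n → a * binom y n) (difference-suc (suc s) i) (⊖ℤ-suc (suc s) i) ⟩
    (ℕ→ℚ (suc s) - ℕ→ℚ i) * binom y (suc s ⊖ℤ i)   ≡⟨ absorption-⊖ s i y ⟩
    y * binom (y - 1ℚ) (s ⊖ℤ i)                    ≡⟨ cong (λ n → y * binom (y - 1ℚ) n) (⊖ℤ-suc s i) ⟨
    y * binom (y - 1ℚ) (suc s ⊖ℤ suc i)            ∎

  pascal-⊖ : ∀ y s → binom y (suc s ⊖ℤ 1) ≡ binom (y - 1ℚ) (suc s ⊖ℤ 1) + binom (y - 1ℚ) (s ⊖ℤ 1)
  -- s = 0: C(y, 0) = C(y-1, 0) and C(y-1, -1) = 0
  pascal-⊖ y zero    = sym (ℚ.+-identityʳ _)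
  pascal-⊖ y (suc s) = begin
    binom y (suc (suc s) ⊖ℤ 1)                       ≡⟨ cong (binom y) (⊖ℤ-one (suc s)) ⟩
    binom y (+ suc s)                                ≡⟨ pascal y s ⟩
    binom (y - 1ℚ) (+ suc s) + binom (y - 1ℚ) (+ s)
      ≡⟨ cong₂ (λ m n → binom (y - 1ℚ) m + binom (y - 1ℚ) n) (⊖ℤ-one (suc s)) (⊖ℤ-one s) ⟨
    binom (y - 1ℚ) (suc (suc s) ⊖ℤ 1) + binom (y - 1ℚ) (suc s ⊖ℤ 1) ∎

  stirling2-vanish : ∀ {n m} → n ℕ.< m → stirling2 n m ≡ 0
  stirling2-vanish {zero}  {suc m} _         = refl
  stirling2-vanish {suc n} {suc m} (s≤s n<m) = begin
    suc m ℕ.* stirling2 n (suc m) ℕ.+ stirling2 n m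
      ≡⟨ cong₂ (λ a b → suc m ℕ.* a ℕ.+ b) (stirling2-vanish (ℕ.m<n⇒m<1+n n<m)) (stirling2-vanish n<m) ⟩
    suc m ℕ.* 0 ℕ.+ 0   ≡⟨ trans (ℕ.+-identityʳ _) (ℕ.*-zeroʳ (suc m)) ⟩
    0                   ∎

  drop-beyond-diagonal : ∀ n (a b : ℚ) → a + b * ℕ→ℚ (stirling2 n (suc n)) ≡ a
  drop-beyond-diagonal n a b = begin
    a + b * ℕ→ℚ (stirling2 n (suc n))  ≡⟨ cong (λ m → a + b * ℕ→ℚ m) (stirling2-vanish (ℕ.n<1+n n)) ⟩
    a + b * 0ℚ                         ≡⟨ cong (λ c → a + c) (ℚ.*-zeroʳ b) ⟩
    a + 0ℚ                             ≡⟨ ℚ.+-identityʳ a ⟩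
    a                                  ∎

  -- the Stirling recurrence {n+1, i} = i {n, i} + {n, i-1} as an operator on sequences
  stirlingStep : (ℕ → ℚ) → ℕ → ℚ
  stirlingStep u zero    = 0ℚ
  stirlingStep u (suc i) = ℕ→ℚ (suc i) * u (suc i) + u i

  stirling2-suc : ∀ n i → ℕ→ℚ (stirling2 (suc n) i) ≡ stirlingStep (λ j → ℕ→ℚ (stirling2 n j)) i
  stirling2-suc n zero    = refl
  stirling2-suc n (suc i) = begin
    ℕ→ℚ (suc i ℕ.* stirling2 n (suc i) ℕ.+ stirling2 n i)
      ≡⟨ ℕ→ℚ-+ (suc i ℕ.* stirling2 n (suc i)) (stirling2 n i) ⟩
    ℕ→ℚ (suc i ℕ.* stirling2 n (suc i)) + ℕ→ℚ (stirling2 n i)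
      ≡⟨ cong (_+ ℕ→ℚ (stirling2 n i)) (ℕ→ℚ-* (suc i) (stirling2 n (suc i))) ⟩
    ℕ→ℚ (suc i) * ℕ→ℚ (stirling2 n (suc i)) + ℕ→ℚ (stirling2 n i) ∎

  -- summation by parts: moving stirlingStep from u onto the coefficients h
  sum0-by-parts : ∀ n (h u : ℕ → ℚ) →
    sum0 n (λ i → h i * stirlingStep u i) + h (suc n) * u n ≡ sum0 n (λ i → (ℕ→ℚ i * h i + h (suc i)) * u i)
  sum0-by-parts zero    h u = base (h 0) (h 1) (u 0)
    where
    base : ∀ h₀ h₁ u₀ → h₀ * 0ℚ + h₁ * u₀ ≡ (0ℚ * h₀ + h₁) * u₀
    base = solve-∀ ℚ-ring
  sum0-by-parts (suc n) h u = begin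
    A + h (suc n) * (N * u (suc n) + u n) + h (suc (suc n)) * u (suc n)
      ≡⟨ regroup A (h (suc n)) N (u (suc n)) (u n) (h (suc (suc n))) ⟩
    A + h (suc n) * u n + (N * h (suc n) + h (suc (suc n))) * u (suc n)
      ≡⟨ cong (_+ (N * h (suc n) + h (suc (suc n))) * u (suc n)) (sum0-by-parts n h u) ⟩
    sum0 (suc n) (λ i → (ℕ→ℚ i * h i + h (suc i)) * u i) ∎
    where
    A = sum0 n (λ i → h i * stirlingStep u i)
    N = ℕ→ℚ (suc n)
    regroup : ∀ A h₁ N u₁ u₀ h₂ → A + h₁ * (N * u₁ + u₀) + h₂ * u₁ ≡ A + h₁ * u₀ + (N * h₁ + h₂) * u₁
    regroup = solve-∀ ℚ-ring

  stirlingSum : ℕ → (ℕ → ℚ) → ℚ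
  stirlingSum n h = sum0 n (λ i → h i * ℕ→ℚ (stirling2 n i))

  stirlingSum-extend : ∀ n h → sum0 (suc n) (λ i → h i * ℕ→ℚ (stirling2 n i)) ≡ stirlingSum n h
  stirlingSum-extend n h = drop-beyond-diagonal n (stirlingSum n h) (h (suc n))

  stirlingSum-step : ∀ n h → stirlingSum (suc n) h ≡ stirlingSum n (λ i → ℕ→ℚ i * h i + h (suc i))
  stirlingSum-step n h = begin
    stirlingSum (suc n) h
      ≡⟨ sum0-cong (suc n) (λ i → cong (h i *_) (stirling2-suc n i)) ⟩
    sum0 (suc n) (λ i → h i * stirlingStep u i)
      ≡⟨ drop-beyond-diagonal n _ (h (suc (suc n))) ⟨
    sum0 (suc n) (λ i → h i * stirlingStep u i) + h (suc (suc n)) * u (suc n)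
      ≡⟨ sum0-by-parts (suc n) h u ⟩
    sum0 (suc n) (λ i → (ℕ→ℚ i * h i + h (suc i)) * u i)
      ≡⟨ stirlingSum-extend n (λ i → ℕ→ℚ i * h i + h (suc i)) ⟩
    stirlingSum n (λ i → ℕ→ℚ i * h i + h (suc i)) ∎
    where
    u : ℕ → ℚ
    u j = ℕ→ℚ (stirling2 n j)

  stirlingSum-cong : ∀ n {f g : ℕ → ℚ} → (∀ i → f i ≡ g i) → stirlingSum n f ≡ stirlingSum n g
  stirlingSum-cong n f≡g = sum0-cong n (λ i → cong (_* ℕ→ℚ (stirling2 n i)) (f≡g i))

  -- since {n+1, 0} = 0, the 0th coefficient does not matter
  stirlingSum-cong⁺ : ∀ n {f g : ℕ → ℚ} → (∀ i → f (suc i) ≡ g (suc i)) →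
    stirlingSum (suc n) f ≡ stirlingSum (suc n) g
  stirlingSum-cong⁺ n {f} {g} f≡g = sum0-cong (suc n) λ where
    zero    → trans (ℚ.*-zeroʳ (f 0)) (sym (ℚ.*-zeroʳ (g 0)))
    (suc i) → cong (_* ℕ→ℚ (stirling2 (suc n) (suc i))) (f≡g i)

  stirlingSum-linear : ∀ n a b (f g : ℕ → ℚ) →
    stirlingSum n (λ i → a * f i - b * g i) ≡ a * stirlingSum n f - b * stirlingSum n g
  stirlingSum-linear n a b f g = begin
    stirlingSum n (λ i → a * f i - b * g i)
      ≡⟨ sum0-cong n (λ i → distrib a b (f i) (g i) (ℕ→ℚ (stirling2 n i))) ⟩
    sum0 n (λ i → a * (f i * ℕ→ℚ (stirling2 n i)) - b * (g i * ℕ→ℚ (stirling2 n i)))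
      ≡⟨ sum0-linear n a b _ _ ⟩
    a * stirlingSum n f - b * stirlingSum n g ∎
    where
    distrib : ∀ a b f g c → (a * f - b * g) * c ≡ a * (f * c) - b * (g * c)
    distrib = solve-∀ ℚ-ring

  -- G k s x plays the role of F_{s,k+1}(x)
  record MoserRecurrence (G : ℕ → ℕ → ℚ → ℚ) : Set where
    field
      initial : ∀ s x → G 0 s x ≡ binom (x - 1ℚ) (s ⊖ℤ 1)
      empty   : ∀ k x → G (suc k) 0 x ≡ 0ℚ
      step    : ∀ k s x → G (suc k) (suc s) x ≡ ℕ→ℚ (suc s) * G k (suc s) x - x * G k s (x - 1ℚ)

  open MoserRecurrence

  recurrence-unique : ∀ {G H} → MoserRecurrence G → MoserRecurrence H → ∀ k s x → G k s x ≡ H k s x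
  recurrence-unique g h zero    s       x = trans (initial g s x) (sym (initial h s x))
  recurrence-unique g h (suc k) zero    x = trans (empty g k x) (sym (empty h k x))
  recurrence-unique {G} {H} g h (suc k) (suc s) x = begin
    G (suc k) (suc s) x                              ≡⟨ step g k s x ⟩
    ℕ→ℚ (suc s) * G k (suc s) x - x * G k s (x - 1ℚ)
      ≡⟨ cong₂ (λ a b → ℕ→ℚ (suc s) * a - x * b)
               (recurrence-unique g h k (suc s) x) (recurrence-unique g h k s (x - 1ℚ)) ⟩
    ℕ→ℚ (suc s) * H k (suc s) x - x * H k s (x - 1ℚ) ≡⟨ step h k s x ⟨
    H (suc k) (suc s) x                              ∎

  -- F_{s,1}(x) = C(x-1, s-1), by alternating the terms and Pascal's rule
  moser-initial : ∀ s x → moser s 1 x ≡ binom (x - 1ℚ) (s ⊖ℤ 1)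
  moser-initial zero    x = refl
  moser-initial (suc s) x = begin
    moser (suc s) 1 x                                  ≡⟨ sum1-peel s f ⟩
    f 1 + sum1 s (λ j → f (suc j))
      ≡⟨ cong (λ c → f 1 + c) (trans (sum1-cong s alternate) (sum1-negate s g)) ⟩
    f 1 + - moser s 1 x
      ≡⟨ cong₂ (λ a b → a + - b) (unit-coefficient (binom x (suc s ⊖ℤ 1))) (moser-initial s x) ⟩
    binom x (suc s ⊖ℤ 1) + - binom (x - 1ℚ) (s ⊖ℤ 1)
      ≡⟨ cong (_+ - binom (x - 1ℚ) (s ⊖ℤ 1)) (pascal-⊖ x s) ⟩
    binom (x - 1ℚ) (suc s ⊖ℤ 1) + binom (x - 1ℚ) (s ⊖ℤ 1) + - binom (x - 1ℚ) (s ⊖ℤ 1)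
      ≡⟨ cancel (binom (x - 1ℚ) (suc s ⊖ℤ 1)) (binom (x - 1ℚ) (s ⊖ℤ 1)) ⟩
    binom (x - 1ℚ) (suc s ⊖ℤ 1)                        ∎
    where
    f g : ℕ → ℚ
    f j = sgn (j ∸ 1) * ℕ→ℚ (j ^ 0) * binom x (suc s ⊖ℤ j)
    g j = sgn (j ∸ 1) * ℕ→ℚ (j ^ 0) * binom x (s ⊖ℤ j)
    negate-left : ∀ a b → - a * 1ℚ * b ≡ - (a * 1ℚ * b)
    negate-left = solve-∀ ℚ-ring
    alternate : ∀ m → f (suc (suc m)) ≡ - g (suc m)
    alternate m = trans (cong (λ n → - sgn m * 1ℚ * binom x n) (⊖ℤ-suc s (suc m))) (negate-left (sgn m) _)
    unit-coefficient : ∀ b → 1ℚ * 1ℚ * b ≡ b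
    unit-coefficient = solve-∀ ℚ-ring
    cancel : ∀ a b → a + b + - b ≡ a
    cancel = solve-∀ ℚ-ring

  -- j^{k+1} C(x, S-j) = S j^k C(x, S-j) - x j^k C(x-1, S-1-j),
  -- given the absorption identity (S - j) C(x, S-j) = x C(x-1, S-1-j)
  power-split : ∀ σ p J S B x B′ → (S - J) * B ≡ x * B′ →
    σ * (J * p) * B ≡ S * (σ * p * B) - x * (σ * p * B′)
  power-split σ p J S B x B′ absorb = begin
    σ * (J * p) * B
      ≡⟨ solve (σ ∷ p ∷ J ∷ S ∷ B ∷ x ∷ B′ ∷ []) ℚ-ring ⟩
    S * (σ * p * B) - x * (σ * p * B′) - σ * p * ((S - J) * B - x * B′)  ≡⟨ discard _ (σ * p) absorb ⟩
    S * (σ * p * B) - x * (σ * p * B′)                                    ∎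

  moser-step : ∀ k s x →
    moser (suc s) (suc (suc k)) x ≡ ℕ→ℚ (suc s) * moser (suc s) (suc k) x - x * moser s (suc k) (x - 1ℚ)
  moser-step k s x = begin
    sum1 (suc s) t                            ≡⟨ sum1-cong (suc s) termwise ⟩
    sum1 (suc s) (λ j → S * u j - x * w j)    ≡⟨ sum1-linear (suc s) S x u w ⟩
    S * sum1 (suc s) u - x * sum1 (suc s) w   ≡⟨ cong (λ c → S * sum1 (suc s) u - x * c) last-term-vanishes ⟩
    S * sum1 (suc s) u - x * sum1 s w         ∎
    where
    S = ℕ→ℚ (suc s)
    t u w : ℕ → ℚ
    t j = sgn (j ∸ 1) * ℕ→ℚ (j ^ suc k) * binom x (suc s ⊖ℤ j)
    u j = sgn (j ∸ 1) * ℕ→ℚ (j ^ k) * binom x (suc s ⊖ℤ j)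
    w j = sgn (j ∸ 1) * ℕ→ℚ (j ^ k) * binom (x - 1ℚ) (s ⊖ℤ j)
    termwise : ∀ m → t (suc m) ≡ S * u (suc m) - x * w (suc m)
    termwise m = begin
      sgn m * ℕ→ℚ (suc m ℕ.* suc m ^ k) * binom x (suc s ⊖ℤ suc m)
        ≡⟨ cong (λ c → sgn m * c * binom x (suc s ⊖ℤ suc m)) (ℕ→ℚ-* (suc m) (suc m ^ k)) ⟩
      sgn m * (ℕ→ℚ (suc m) * ℕ→ℚ (suc m ^ k)) * binom x (suc s ⊖ℤ suc m)
        ≡⟨ power-split (sgn m) _ (ℕ→ℚ (suc m)) S _ x _ (absorption-⊖ s (suc m) x) ⟩
      S * u (suc m) - x * w (suc m) ∎
    -- the term j = s+1 of F_{s,k+1}(x-1) has lower index -1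
    last-term-vanishes : sum1 (suc s) w ≡ sum1 s w
    last-term-vanishes = begin
      sum1 s w + sgn s * ℕ→ℚ (suc s ^ k) * binom (x - 1ℚ) (s ⊖ℤ suc s)
        ≡⟨ cong (λ n → sum1 s w + sgn s * ℕ→ℚ (suc s ^ k) * binom (x - 1ℚ) n) (⊖ℤ-suc-self s) ⟩
      sum1 s w + sgn s * ℕ→ℚ (suc s ^ k) * 0ℚ
        ≡⟨ cong (λ c → sum1 s w + c) (ℚ.*-zeroʳ (sgn s * ℕ→ℚ (suc s ^ k))) ⟩
      sum1 s w + 0ℚ                       ≡⟨ ℚ.+-identityʳ _ ⟩
      sum1 s w                            ∎

  moser-recurrence : MoserRecurrence (λ k s x → moser s (suc k) x)
  moser-recurrence = record { initial = moser-initial ; empty = λ _ _ → refl ; step = moser-step }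

  coef₁ : ℕ → ℚ → ℕ → ℚ
  coef₁ s x i = sgn (i ∸ 1) * ℕ→ℚ ((i ∸ 1) !) * binom (x - ℕ→ℚ i) (s ⊖ℤ i)

  -- i c_i + c_{i+1} = S c_i - x c′_i, using (S - i) C(x-i, S-i) = (x-i) C(x-i-1, S-1-i)
  shift-algebra : ∀ σ F I S x B B′ → (S - I) * B ≡ (x - I) * B′ →
    I * (σ * F * B) + - σ * (I * F) * B′ ≡ S * (σ * F * B) - x * (σ * F * B′)
  shift-algebra σ F I S x B B′ absorb = begin
    I * (σ * F * B) + - σ * (I * F) * B′
      ≡⟨ solve (σ ∷ F ∷ I ∷ S ∷ x ∷ B ∷ B′ ∷ []) ℚ-ring ⟩
    S * (σ * F * B) - x * (σ * F * B′) - σ * F * ((S - I) * B - (x - I) * B′) ≡⟨ discard _ (σ * F) absorb ⟩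
    S * (σ * F * B) - x * (σ * F * B′)                                      ∎

  coef₁-step : ∀ s x m →
    ℕ→ℚ (suc m) * coef₁ (suc s) x (suc m) + coef₁ (suc s) x (suc (suc m))
      ≡ ℕ→ℚ (suc s) * coef₁ (suc s) x (suc m) - x * coef₁ s (x - 1ℚ) (suc m)
  coef₁-step s x m = begin
    I * (σ * F * B) + coef₁ (suc s) x (suc i)  ≡⟨ cong (λ c → I * (σ * F * B) + c) next ⟩
    I * (σ * F * B) + - σ * (I * F) * B′       ≡⟨ shift-algebra σ F I S x B B′ (absorption-⊖ s i (x - I)) ⟩
    S * (σ * F * B) - x * (σ * F * B′)
      ≡⟨ cong (λ c → S * (σ * F * B) - x * (σ * F * binom c (s ⊖ℤ i))) (swap-shifts x I) ⟨
    S * coef₁ (suc s) x i - x * coef₁ s (x - 1ℚ) i ∎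
    where
    i = suc m
    I = ℕ→ℚ i
    σ = sgn m
    F = ℕ→ℚ (m !)
    S = ℕ→ℚ (suc s)
    B = binom (x - I) (suc s ⊖ℤ i)
    B′ = binom (x - I - 1ℚ) (s ⊖ℤ i)
    next : coef₁ (suc s) x (suc i) ≡ - σ * (I * F) * B′
    next = cong₂ (λ c b → - σ * c * b) (ℕ→ℚ-* i (m !)) (cong₂ binom (minus-suc x i) (⊖ℤ-suc s i))
    swap-shifts : ∀ x a → x - 1ℚ - a ≡ x - a - 1ℚ
    swap-shifts = solve-∀ ℚ-ring

  stirling₁-recurrence : MoserRecurrence (λ k s x → stirlingSum (suc k) (coef₁ s x))
  stirling₁-recurrence = record { initial = initial₁ ; empty = empty₁ ; step = step₁ }
    where
    initial₁ : ∀ s x → stirlingSum 1 (coef₁ s x) ≡ binom (x - 1ℚ) (s ⊖ℤ 1)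
    initial₁ s x = only-term (coef₁ s x 0) (binom (x - 1ℚ) (s ⊖ℤ 1))
      where
      only-term : ∀ c b → c * 0ℚ + 1ℚ * 1ℚ * b * 1ℚ ≡ b
      only-term = solve-∀ ℚ-ring
    -- for s = 0 every term vanishes: {k,0} = 0 and C(x-i, -i) = 0 for i ≥ 1
    empty₁ : ∀ k x → stirlingSum (suc (suc k)) (coef₁ 0 x) ≡ 0ℚ
    empty₁ k x = sum0-zero (suc (suc k)) (λ i → coef₁ 0 x i * ℕ→ℚ (stirling2 (suc (suc k)) i)) λ where
      zero    → ℚ.*-zeroʳ (coef₁ 0 x 0)
      (suc i) → trans (cong (_* ℕ→ℚ (stirling2 (suc (suc k)) (suc i))) (ℚ.*-zeroʳ (sgn i * ℕ→ℚ (i !))))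
                      (ℚ.*-zeroˡ (ℕ→ℚ (stirling2 (suc (suc k)) (suc i))))
    step₁ : ∀ k s x → stirlingSum (suc (suc k)) (coef₁ (suc s) x)
                    ≡ ℕ→ℚ (suc s) * stirlingSum (suc k) (coef₁ (suc s) x) - x * stirlingSum (suc k) (coef₁ s (x - 1ℚ))
    step₁ k s x = begin
      stirlingSum (suc (suc k)) (coef₁ (suc s) x)
        ≡⟨ stirlingSum-step (suc k) (coef₁ (suc s) x) ⟩
      stirlingSum (suc k) (λ i → ℕ→ℚ i * coef₁ (suc s) x i + coef₁ (suc s) x (suc i))
        ≡⟨ stirlingSum-cong⁺ k {f = λ i → ℕ→ℚ i * coef₁ (suc s) x i + coef₁ (suc s) x (suc i)}
                               {g = λ i → ℕ→ℚ (suc s) * coef₁ (suc s) x i - x * coef₁ s (x - 1ℚ) i}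
                               (coef₁-step s x) ⟩
      stirlingSum (suc k) (λ i → ℕ→ℚ (suc s) * coef₁ (suc s) x i - x * coef₁ s (x - 1ℚ) i)
        ≡⟨ stirlingSum-linear (suc k) (ℕ→ℚ (suc s)) x _ _ ⟩
      ℕ→ℚ (suc s) * stirlingSum (suc k) (coef₁ (suc s) x) - x * stirlingSum (suc k) (coef₁ s (x - 1ℚ)) ∎

  expansion₁-stirlingSum : ∀ k s x →
    sum1 (suc k) (λ i → sgn (i ∸ 1) * ℕ→ℚ ((i ∸ 1) !) * ℕ→ℚ (stirling2 (suc k) i) * binom (x - ℕ→ℚ i) (s ⊖ℤ i))
      ≡ stirlingSum (suc k) (coef₁ s x)
  expansion₁-stirlingSum k s x =
    trans (sum1-cong (suc k) (λ i → swap (sgn i * ℕ→ℚ (i !)) _ _))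
          (sum1≡sum0 (suc k) _ (ℚ.*-zeroʳ (coef₁ s x 0)))
    where
    swap : ∀ a b c → a * b * c ≡ a * c * b
    swap = solve-∀ ℚ-ring

  coef₂ : ℕ → ℕ → ℚ → ℕ → ℚ
  coef₂ k s x i = sgn (i ℕ.+ k) * ℕ→ℚ (i !) * binom (x - ℕ→ℚ i - 1ℚ) (s ⊖ℤ 1)

  -- i c_i + c_{i+1} = S c_i - x c′_i, using Pascal's rule B₁ = B₂ + B₃ and absorption
  pascal-algebra : ∀ σ F I S x {B₁} B₂ B₃ → B₁ ≡ B₂ + B₃ → (S - 1ℚ) * B₁ ≡ (x - I - 1ℚ) * B₃ →
    I * (- σ * F * B₁) + - - σ * ((1ℚ + I) * F) * B₂ ≡ S * (σ * F * B₁) - x * (σ * F * B₃)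
  pascal-algebra σ F I S x B₂ B₃ refl absorb = begin
    I * (- σ * F * (B₂ + B₃)) + - - σ * ((1ℚ + I) * F) * B₂
      ≡⟨ solve (σ ∷ F ∷ I ∷ S ∷ x ∷ B₂ ∷ B₃ ∷ []) ℚ-ring ⟩
    S * (σ * F * (B₂ + B₃)) - x * (σ * F * B₃) - σ * F * ((S - 1ℚ) * (B₂ + B₃) - (x - I - 1ℚ) * B₃)
      ≡⟨ discard _ (σ * F) absorb ⟩
    S * (σ * F * (B₂ + B₃)) - x * (σ * F * B₃) ∎

  coef₂-step : ∀ k s x i →
    ℕ→ℚ i * coef₂ (suc k) (suc s) x i + coef₂ (suc k) (suc s) x (suc i)
      ≡ ℕ→ℚ (suc s) * coef₂ k (suc s) x i - x * coef₂ k s (x - 1ℚ) i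
  coef₂-step k s x i = begin
    I * coef₂ (suc k) (suc s) x i + coef₂ (suc k) (suc s) x (suc i) ≡⟨ cong₂ (λ a b → I * a + b) this next ⟩
    I * (- σ * F * B₁) + - - σ * ((1ℚ + I) * F) * B₂
      ≡⟨ pascal-algebra σ F I S x B₂ B₃ (pascal-⊖ y s) (absorption-⊖ s 1 y) ⟩
    S * (σ * F * B₁) - x * (σ * F * B₃)
      ≡⟨ cong (λ c → S * (σ * F * B₁) - x * (σ * F * binom c (s ⊖ℤ 1))) (swap-shifts x I) ⟨
    S * coef₂ k (suc s) x i - x * coef₂ k s (x - 1ℚ) i ∎
    where
    I = ℕ→ℚ i
    σ = sgn (i ℕ.+ k)
    F = ℕ→ℚ (i !)
    S = ℕ→ℚ (suc s)
    y = x - I - 1ℚ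
    B₁ = binom y (suc s ⊖ℤ 1)
    B₂ = binom (y - 1ℚ) (suc s ⊖ℤ 1)
    B₃ = binom (y - 1ℚ) (s ⊖ℤ 1)
    this : coef₂ (suc k) (suc s) x i ≡ - σ * F * B₁
    this = cong (λ n → sgn n * F * B₁) (ℕ.+-suc i k)
    next : coef₂ (suc k) (suc s) x (suc i) ≡ - - σ * ((1ℚ + I) * F) * B₂
    next = cong₂ _*_ (cong₂ _*_ (cong (λ n → - sgn n) (ℕ.+-suc i k))
                                (trans (ℕ→ℚ-* (suc i) (i !)) (cong (_* F) (ℕ→ℚ-suc i))))
                     (cong (λ c → binom (c - 1ℚ) (suc s ⊖ℤ 1)) (minus-suc x i))
    swap-shifts : ∀ x a → x - 1ℚ - a - 1ℚ ≡ x - a - 1ℚ - 1ℚ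
    swap-shifts = solve-∀ ℚ-ring

  stirling₂-recurrence : MoserRecurrence (λ k s x → stirlingSum k (coef₂ k s x))
  stirling₂-recurrence = record { initial = initial₂ ; empty = empty₂ ; step = step₂ }
    where
    initial₂ : ∀ s x → stirlingSum 0 (coef₂ 0 s x) ≡ binom (x - 1ℚ) (s ⊖ℤ 1)
    initial₂ s x = trans (unit-coefficients (binom (x - 0ℚ - 1ℚ) (s ⊖ℤ 1)))
                         (cong (λ c → binom c (s ⊖ℤ 1)) (drop-zero x))
      where
      unit-coefficients : ∀ b → 1ℚ * 1ℚ * b * 1ℚ ≡ b
      unit-coefficients = solve-∀ ℚ-ring
      drop-zero : ∀ x → x - 0ℚ - 1ℚ ≡ x - 1ℚ
      drop-zero = solve-∀ ℚ-ring
    -- for s = 0 every binomial C(x-i-1, -1) vanishes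
    empty₂ : ∀ k x → stirlingSum (suc k) (coef₂ (suc k) 0 x) ≡ 0ℚ
    empty₂ k x = sum0-zero (suc k) (λ i → coef₂ (suc k) 0 x i * ℕ→ℚ (stirling2 (suc k) i)) λ i →
      trans (cong (_* ℕ→ℚ (stirling2 (suc k) i)) (ℚ.*-zeroʳ (sgn (i ℕ.+ suc k) * ℕ→ℚ (i !))))
            (ℚ.*-zeroˡ (ℕ→ℚ (stirling2 (suc k) i)))
    step₂ : ∀ k s x → stirlingSum (suc k) (coef₂ (suc k) (suc s) x)
                    ≡ ℕ→ℚ (suc s) * stirlingSum k (coef₂ k (suc s) x) - x * stirlingSum k (coef₂ k s (x - 1ℚ))
    step₂ k s x = begin
      stirlingSum (suc k) (coef₂ (suc k) (suc s) x)
        ≡⟨ stirlingSum-step k (coef₂ (suc k) (suc s) x) ⟩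
      stirlingSum k (λ i → ℕ→ℚ i * coef₂ (suc k) (suc s) x i + coef₂ (suc k) (suc s) x (suc i))
        ≡⟨ stirlingSum-cong k (coef₂-step k s x) ⟩
      stirlingSum k (λ i → ℕ→ℚ (suc s) * coef₂ k (suc s) x i - x * coef₂ k s (x - 1ℚ) i)
        ≡⟨ stirlingSum-linear k (ℕ→ℚ (suc s)) x _ _ ⟩
      ℕ→ℚ (suc s) * stirlingSum k (coef₂ k (suc s) x) - x * stirlingSum k (coef₂ k s (x - 1ℚ)) ∎

  -- the right-hand side as stated is this Stirling sum (its top term carries {k, k+1} = 0)
  expansion₂-stirlingSum : ∀ k s x →
    sum0 (suc k) (λ i → sgn (i ℕ.+ suc k ∸ 1) * ℕ→ℚ (i !) * ℕ→ℚ (stirling2 (suc k ∸ 1) i)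
                          * binom (x - ℕ→ℚ i - ℕ→ℚ 1) (s ⊖ℤ 1))
      ≡ stirlingSum k (coef₂ k s x)
  expansion₂-stirlingSum k s x =
    trans (sum0-cong (suc k) λ i →
             trans (cong (λ n → sgn n * ℕ→ℚ (i !) * ℕ→ℚ (stirling2 k i) * binom (x - ℕ→ℚ i - 1ℚ) (s ⊖ℤ 1))
                         (cong (_∸ 1) (ℕ.+-suc i k)))
                   (swap (sgn (i ℕ.+ k) * ℕ→ℚ (i !)) _ _))
          (stirlingSum-extend k (coef₂ k s x))
    where
    swap : ∀ a b c → a * b * c ≡ a * c * b
    swap = solve-∀ ℚ-ring

open MoserStirling using (recurrence-unique; moser-recurrence; stirling₁-recurrence; stirling₂-recurrence;
                          expansion₁-stirlingSum; expansion₂-stirlingSum)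
open import Defs
open import Data.Nat using (ℕ; suc; _≤_; _∸_; _+_; _!)
open import Data.Rational using (ℚ; _*_; _-_)
open import Relation.Binary.PropositionalEquality using (_≡_; sym; trans)
open import Data.Product using (_×_; _,_)

-- Proposition 3.12: both sides satisfy Moser's recurrence in k, hence agree.
proposition3p12 : (s k : ℕ) → 1 ≤ s → 1 ≤ k → (x : ℚ) →
    (moser s k x ≡ sum1 k (λ i → sgn (i ∸ 1) * ℕ→ℚ ((i ∸ 1) !) * ℕ→ℚ (stirling2 k i) * binom (x - ℕ→ℚ i) (s ⊖ℤ i)))
    × (moser s k x ≡ sum0 k (λ i → sgn (i + k ∸ 1) * ℕ→ℚ (i !) * ℕ→ℚ (stirling2 (k ∸ 1) i) * binom (x - ℕ→ℚ i - ℕ→ℚ 1) (s ⊖ℤ 1)))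
proposition3p12 s (suc k) _ _ x =
    trans (recurrence-unique moser-recurrence stirling₁-recurrence k s x) (sym (expansion₁-stirlingSum k s x))
  , trans (recurrence-unique moser-recurrence stirling₂-recurrence k s x) (sym (expansion₂-stirlingSum k s x))
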